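{- Let $n$ and $k$ be positive integers with $1\leq k\leq \binom{n}{2}$. Then $g(n,k)=\binom{n}{2}$ if $k=\binom{n}{2}$; and for each integer $t$ with $2\leq t\leq n-1$, $$g(n,k)=\begin{cases} k+t-1 & \text{if } \binom{n-t}{2}+t(n-t-1)+1\leq k\leq \binom{n-t}{2}+t(n-t)-1,\\[2pt] k+t-2 & \text{if } k=\binom{n-t}{2}+t(n-t).\end{cases}$$
   Context: All graphs are finite, simple and undirected. For a connected graph $G$, an edge-coloring of $G$ (adjacent edges may receive the same color) is a monochromatic connection coloring (MC-coloring) if any two vertices of $G$ are joined by a path all of whose edges have the same color. The monochromatic connection number $mc(G)$ is the maximum number of colors used in an MC-coloring of $G$. For positive integers $n,k$ with $1\leq k\leq\binom{n}{2}$, $g(n,k)$ is the maximum integer such that every connected graph $G$ on $n$ vertices with $|E(G)|\leq g(n,k)$ satisfies $mc(G)\leq k$. -}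

module Defs where

open import Data.Nat using (ℕ; zero; suc; _+_; _*_; _∸_; _≤_; _<ᵇ_)
open import Data.Nat.Combinatorics using (_C_)
open import Data.Fin using (Fin; toℕ)
open import Data.Bool using (Bool; true; false; _∧_; if_then_else_)
open import Data.List using (List; map; concatMap; allFin)
open import Data.Nat.ListAction using (sum)
open import Data.Product using (_×_; _,_; Σ; ∃)
open import Relation.Binary.PropositionalEquality using (_≡_)

record Graph (n : ℕ) : Set where
  field
    adj    : Fin n → Fin n → Bool
    sym    : ∀ u v → adj u v ≡ adj v u
    irrefl : ∀ u → adj u u ≡ false
open Graph public

edgeCount : ∀ {n} → Graph n → ℕ
edgeCount {n} G =
  sum (concatMap (λ i → map (λ j → if (toℕ i <ᵇ toℕ j) ∧ adj G i j then 1 else 0)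
                            (allFin n))
                 (allFin n))

data Walk {n} (G : Graph n) : Fin n → Fin n → Set where
  here : ∀ {u} → Walk G u u
  step : ∀ {u v w} → adj G u v ≡ true → Walk G v w → Walk G u w

Connected : ∀ {n} → Graph n → Set
Connected G = ∀ u v → Walk G u v

-- An edge-coloring of G with colour set Fin j: a colour for every
-- (ordered) pair of vertices, required to be symmetric on edges
-- (so it is a colouring of the undirected edges; values on non-edges are irrelevant).
record EdgeColoring {n} (G : Graph n) (j : ℕ) : Set where
  field
    col    : Fin n → Fin n → Fin j
    colSym : ∀ u v → adj G u v ≡ true → col u v ≡ col v u
open EdgeColoring public

-- The colouring uses all j colours (every colour appears on some edge).
-- A colouring using exactly j distinct colours is, up to renaming, such a colouring.
UsesAll : ∀ {n} {G : Graph n} {j} → EdgeColoring G j → Set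
UsesAll {n} {G} {j} c = ∀ (a : Fin j) → Σ (Fin n) λ u → Σ (Fin n) λ v →
  (adj G u v ≡ true) × (col c u v ≡ a)

-- Monochromatic walks (all edges of colour a).  A monochromatic walk
-- contains a monochromatic path between its ends, so this is equivalent.
data MonoWalk {n} (G : Graph n) {j} (c : EdgeColoring G j) (a : Fin j)
     : Fin n → Fin n → Set where
  here : ∀ {u} → MonoWalk G c a u u
  step : ∀ {u v w} → adj G u v ≡ true → col c u v ≡ a →
         MonoWalk G c a v w → MonoWalk G c a u w

IsMC : ∀ {n} {G : Graph n} {j} → EdgeColoring G j → Set
IsMC {n} {G} {j} c = ∀ u v → ∃ λ (a : Fin j) → MonoWalk G c a u v

mcLe : ∀ {n} → Graph n → ℕ → Set
mcLe G k = ∀ j (c : EdgeColoring G j) → UsesAll c → IsMC c → j ≤ k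

GoodBound : ℕ → ℕ → ℕ → Set
GoodBound n k m = ∀ (G : Graph n) → Connected G → edgeCount G ≤ m → mcLe G k

IsG : ℕ → ℕ → ℕ → Set
IsG n k v = (v ≤ n C 2) × GoodBound n k v ×
            (∀ m → m ≤ n C 2 → GoodBound n k m → m ≤ v)

module Submission where

-- Let c be an MC-colouring of a connected graph with m edges by j colours, colour a having
-- eₐ edges.  The components of colour a have sizes sᵢ with Σ (sᵢ − 1) ≤ eₐ, so colour a joins at
-- most n + eₐ(eₐ + 1) ordered pairs of vertices (each u with itself included).  Every ordered pair
-- is joined by some colour, hence n² ≤ n + Σₐ eₐ(eₐ + 1); since Σₐ (eₐ − 1) = m − j this gives
-- C(n,2) ≤ m + C(m − j + 1, 2).  Therefore j ≤ k whenever m + C(m − k, 2) < C(n,2), which is the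
-- claimed lower bound on g(n,k).
--
-- For the matching upper bound, join vertex 0 to 1, …, s − 1, vertex 1 to 2, …, x + 1, and every
-- pair whose larger end is ≥ s.  One colour on the star at 0 and a fresh colour on every other
-- edge is an MC-colouring (two vertices below s meet at 0) with 1 + x + C(n,2) − C(s,2) colours on
-- s − 1 + x + C(n,2) − C(s,2) edges; s and x are chosen to give k + 1 colours on one edge more
-- than the claimed value of g(n,k).

open import Defs hiding (sym)

open import Data.Bool using (Bool; true; false; if_then_else_; T; _∧_)
open import Data.Bool.Properties using (T-≡)
open import Data.Fin using (Fin; zero; suc; toℕ; fromℕ<)
import Data.Fin.Properties as Fin
open import Data.List using (List; []; _∷_; allFin; map; tabulate; concatMap)
open import Data.List.Membership.Propositional using (_∈_)
open import Data.List.Membership.Propositional.Properties using (∈-allFin)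
import Data.List.Properties as Listₚ
open import Data.List.Relation.Unary.Any using (here; there)
open import Data.Nat using (ℕ; zero; suc; _+_; _*_; _∸_; _≤_; _<_; z≤n; s≤s; _≡ᵇ_; _<ᵇ_; _⊓_; _⊔_)
open import Data.Nat.Combinatorics using (_C_; nCk+nC[k+1]≡[n+1]C[k+1]; nC1≡n)
import Data.Nat.ListAction as List
import Data.Nat.ListAction.Properties as List
open import Data.Nat.Properties
open import Data.Nat.Tactic.RingSolver using (solve-∀)
open import Data.Product using (_×_; _,_; ∃; Σ; proj₁; proj₂)
open import Data.Sum using (_⊎_; inj₁; inj₂)
open import Data.Unit using (tt)
open import Function using (_∘_)
open import Function.Bundles using (module Equivalence)
open import Relation.Binary.Definitions using (tri<; tri≈; tri>)
open import Relation.Binary.PropositionalEquality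
open import Relation.Nullary using (¬_; yes; no; contradiction)
open import Relation.Nullary.Decidable using (does; dec-true; dec-false)

open Equivalence using (to; from)
open import Algebra.Properties.Semiring.Sum +-*-semiring
  using (sum-syntax; sum-cong-≗; ∑-distrib-+; ∑-comm; sum-replicate-zero; *-distribʳ-sum)

m≢n⇒m⊓n<m⊔n : ∀ {m n} → m ≢ n → m ⊓ n < m ⊔ n
m≢n⇒m⊓n<m⊔n {m} {n} m≢n with <-cmp m n
... | tri< m<n _ _ = subst₂ _<_ (sym (m≤n⇒m⊓n≡m (<⇒≤ m<n))) (sym (m≤n⇒m⊔n≡n (<⇒≤ m<n))) m<n
... | tri≈ _ m≡n _ = contradiction m≡n m≢n
... | tri> _ _ n<m = subst₂ _<_ (sym (m≥n⇒m⊓n≡n (<⇒≤ n<m))) (sym (m≥n⇒m⊔n≡m (<⇒≤ n<m))) n<m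

≤∸1⇒< : ∀ {k m} → 1 ≤ m → k ≤ m ∸ 1 → k < m
≤∸1⇒< {m = suc m} _ k≤m = s≤s k≤m

𝟙 : Bool → ℕ
𝟙 b = if b then 1 else 0

𝟙≤1 : ∀ b → 𝟙 b ≤ 1
𝟙≤1 true  = ≤-refl
𝟙≤1 false = z≤n

δ : ∀ {n} → Fin n → Fin n → ℕ
δ x y = 𝟙 (does (x Fin.≟ y))

δ-refl : ∀ {n} (x : Fin n) → δ x x ≡ 1
δ-refl x = cong 𝟙 (dec-true (x Fin.≟ x) refl)

δ-≢ : ∀ {n} {x y : Fin n} → x ≢ y → δ x y ≡ 0
δ-≢ {x = x} {y} x≢y = cong 𝟙 (dec-false (x Fin.≟ y) x≢y)

δ-sym : ∀ {n} (x y : Fin n) → δ x y ≡ δ y x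
δ-sym x y with x Fin.≟ y | y Fin.≟ x
... | yes _   | yes _   = refl
... | no _    | no _    = refl
... | yes x≡y | no y≢x = contradiction (sym x≡y) y≢x
... | no x≢y  | yes y≡x = contradiction (sym y≡x) x≢y

∑-mono-≤ : ∀ {n} {f g : Fin n → ℕ} → (∀ i → f i ≤ g i) → ∑[ i < n ] f i ≤ ∑[ i < n ] g i
∑-mono-≤ {zero}  f≤g = z≤n
∑-mono-≤ {suc n} f≤g = +-mono-≤ (f≤g zero) (∑-mono-≤ (f≤g ∘ suc))

term≤∑ : ∀ {n} (f : Fin n → ℕ) i → f i ≤ ∑[ j < n ] f j
term≤∑ f zero    = m≤m+n (f zero) _
term≤∑ f (suc i) = ≤-trans (term≤∑ (λ j → f (suc j)) i) (m≤n+m _ (f zero))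

∑-const : ∀ n c → ∑[ i < n ] c ≡ n * c
∑-const zero    c = refl
∑-const (suc n) c = cong (c +_) (∑-const n c)

∑-*ʳ : ∀ {n} (f : Fin n → ℕ) c → ∑[ i < n ] (f i * c) ≡ (∑[ i < n ] f i) * c
∑-*ʳ f c = sym (*-distribʳ-sum c f)

∃-positive-term : ∀ {n} (f : Fin n → ℕ) → 1 ≤ ∑[ i < n ] f i → ∃ λ i → 1 ≤ f i
∃-positive-term {suc n} f 1≤∑ with f zero in f0≡
... | suc _ = zero , subst (1 ≤_) (sym f0≡) (s≤s z≤n)
... | zero with ∃-positive-term (λ i → f (suc i)) 1≤∑
...   | i , 1≤fi = suc i , 1≤fi

∑-δ : ∀ {n} (f : Fin n → ℕ) x → ∑[ i < n ] (δ i x * f i) ≡ f x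
∑-δ {suc n} f zero    = begin
  1 * f zero + ∑[ i < n ] (0 * f (suc i))  ≡⟨ cong (1 * f zero +_) (sum-replicate-zero n) ⟩
  1 * f zero + 0                           ≡⟨ +-identityʳ _ ⟩
  1 * f zero                               ≡⟨ *-identityˡ _ ⟩
  f zero                                   ∎
  where open ≡-Reasoning
∑-δ {suc n} f (suc x) = ∑-δ (λ i → f (suc i)) x

∑-δ-count : ∀ {n} (x : Fin n) → ∑[ i < n ] δ i x ≡ 1
∑-δ-count {n} x = trans (sum-cong-≗ (λ i → sym (*-identityʳ (δ i x)))) (∑-δ (λ _ → 1) x)

∑∑-1+δ* : ∀ n c → ∑[ u < n ] ∑[ v < n ] (1 + δ u v * c) ≡ n * n + c * n
∑∑-1+δ* n c = begin
  ∑[ u < n ] ∑[ v < n ] (1 + δ u v * c)       ≡⟨ sum-cong-≗ row ⟩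
  ∑[ u < n ] (n + c)                          ≡⟨ ∑-const n (n + c) ⟩
  n * (n + c)                                 ≡⟨ expand n c ⟩
  n * n + c * n                               ∎
  where
  open ≡-Reasoning
  expand : ∀ n c → n * (n + c) ≡ n * n + c * n
  expand = solve-∀
  row : ∀ u → ∑[ v < n ] (1 + δ u v * c) ≡ n + c
  row u = begin
    ∑[ v < n ] (1 + δ u v * c)                  ≡⟨ ∑-distrib-+ (λ _ → 1) (λ v → δ u v * c) ⟩
    ∑[ v < n ] 1 + ∑[ v < n ] (δ u v * c)       ≡⟨ cong₂ _+_ (trans (∑-const n 1) (*-identityʳ n))
                                                       (trans (sum-cong-≗ (λ v → cong (_* c) (δ-sym u v))) (∑-δ (λ _ → c) u)) ⟩
    n + c                                       ∎

-- Pooling all the excesses f i ∸ 1 into one block only increases the sum of squares.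
∑-square≤ : ∀ {n} (f : Fin n → ℕ) →
  ∑[ i < n ] (f i * f i) ≤ ∑[ i < n ] f i + (∑[ i < n ] (f i ∸ 1)) * suc (∑[ i < n ] (f i ∸ 1))
∑-square≤ {zero}  f = z≤n
∑-square≤ {suc n} f with f zero | ∑-square≤ (f ∘ suc)
... | zero  | ih = ih
... | suc p | ih = begin
  suc p * suc p + ∑[ i < n ] (f (suc i) * f (suc i))  ≤⟨ +-monoʳ-≤ (suc p * suc p) ih ⟩
  suc p * suc p + (s + e * suc e)                   ≤⟨ m≤m+n _ (2 * p * e) ⟩
  suc p * suc p + (s + e * suc e) + 2 * p * e       ≡⟨ expand p s e ⟩
  suc p + s + (p + e) * suc (p + e)                 ∎
  where
  open ≤-Reasoning
  s = ∑[ i < n ] f (suc i)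
  e = ∑[ i < n ] (f (suc i) ∸ 1)
  expand : ∀ p s e → suc p * suc p + (s + e * suc e) + 2 * p * e ≡ suc p + s + (p + e) * suc (p + e)
  expand = solve-∀

∑≤1 : ∀ {n} (f : Fin n → ℕ) → (∀ i → f i ≤ 1) → (∀ {i j} → 1 ≤ f i → 1 ≤ f j → i ≡ j) →
      ∑[ i < n ] f i ≤ 1
∑≤1 {zero}  f f≤1 unique = z≤n
∑≤1 {suc n} f f≤1 unique with f zero in f0≡ | f≤1 zero
... | zero        | _      = ∑≤1 (f ∘ suc) (f≤1 ∘ suc) (λ p q → Fin.suc-injective (unique p q))
... | suc (suc _) | s≤s ()
... | suc zero    | _      = ≤-reflexive (cong suc (trans (sum-cong-≗ rest≡0) (sum-replicate-zero n)))
  where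
  rest≡0 : ∀ i → f (suc i) ≡ 0
  rest≡0 i with f (suc i) in fi≡ | f≤1 (suc i)
  ... | zero        | _      = refl
  ... | suc (suc _) | s≤s ()
  ... | suc zero    | _      with unique (≤-reflexive (sym f0≡)) (≤-reflexive (sym fi≡))
  ...   | ()

∑∑≤1 : ∀ {m n} (g : Fin m → Fin n → ℕ) → (∀ u v → g u v ≤ 1) →
       (∀ {u v u′ v′} → 1 ≤ g u v → 1 ≤ g u′ v′ → u ≡ u′ × v ≡ v′) →
       ∑[ u < m ] ∑[ v < n ] g u v ≤ 1
∑∑≤1 {n = n} g g≤1 unique = ∑≤1 _ row≤1 λ {u} {u′} p q →
  proj₁ (unique (proj₂ (∃-positive-term (g u) p)) (proj₂ (∃-positive-term (g u′) q)))
  where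
  row≤1 : ∀ u → ∑[ v < n ] g u v ≤ 1
  row≤1 u = ∑≤1 (g u) (g≤1 u) (λ p q → proj₂ (unique p q))

∑-𝟙[toℕ≡] : ∀ {K} m → m < K → ∑[ b < K ] 𝟙 (toℕ b ≡ᵇ m) ≡ 1
∑-𝟙[toℕ≡] {suc K} zero    _         = cong suc (sum-replicate-zero K)
∑-𝟙[toℕ≡] {suc K} (suc m) (s≤s m<K) = ∑-𝟙[toℕ≡] m m<K

𝟙*-positive : ∀ c x → 1 ≤ 𝟙 c * x → T c × 1 ≤ x
𝟙*-positive true x p = tt , subst (1 ≤_) (+-identityʳ x) p

-- h u v ≤ Σ_b [b ≡ key u v] · h u v, and for each fixed b at most one pair (u, v) contributes.
∑∑≤-by-injection : ∀ {m n} K (h key : Fin m → Fin n → ℕ) → (∀ u v → h u v ≤ 1) →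
  (∀ {u v} → h u v ≡ 1 → key u v < K) →
  (∀ {u v u′ v′} → h u v ≡ 1 → h u′ v′ ≡ 1 → key u v ≡ key u′ v′ → u ≡ u′ × v ≡ v′) →
  ∑[ u < m ] ∑[ v < n ] h u v ≤ K
∑∑≤-by-injection {m} {n} K h key h≤1 key<K key-injective = begin
  ∑[ u < m ] ∑[ v < n ] h u v                      ≤⟨ ∑-mono-≤ (λ u → ∑-mono-≤ (h≤∑hit u)) ⟩
  ∑[ u < m ] ∑[ v < n ] ∑[ b < K ] hit b u v       ≡⟨ sum-cong-≗ (λ u → ∑-comm (λ v b → hit b u v)) ⟩
  ∑[ u < m ] ∑[ b < K ] ∑[ v < n ] hit b u v       ≡⟨ ∑-comm (λ u b → ∑[ v < n ] hit b u v) ⟩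
  ∑[ b < K ] ∑[ u < m ] ∑[ v < n ] hit b u v       ≤⟨ ∑-mono-≤ (λ b → ∑∑≤1 (hit b) (hit≤1 b) (hit-unique b)) ⟩
  ∑[ b < K ] 1                                     ≡⟨ ∑-const K 1 ⟩
  K * 1                                            ≡⟨ *-identityʳ K ⟩
  K                                                ∎
  where
  open ≤-Reasoning
  hit : Fin K → Fin m → Fin n → ℕ
  hit b u v = 𝟙 (toℕ b ≡ᵇ key u v) * h u v

  h≤∑hit : ∀ u v → h u v ≤ ∑[ b < K ] hit b u v
  h≤∑hit u v with h u v in h≡ | h≤1 u v
  ... | zero        | _      = z≤n
  ... | suc (suc _) | s≤s ()
  ... | suc zero    | _      = ≤-reflexive (sym (begin-equality
    ∑[ b < K ] (𝟙 (toℕ b ≡ᵇ key u v) * 1)   ≡⟨ ∑-*ʳ {K} (λ b → 𝟙 (toℕ b ≡ᵇ key u v)) 1 ⟩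
    (∑[ b < K ] 𝟙 (toℕ b ≡ᵇ key u v)) * 1   ≡⟨ *-identityʳ _ ⟩
    ∑[ b < K ] 𝟙 (toℕ b ≡ᵇ key u v)         ≡⟨ ∑-𝟙[toℕ≡] (key u v) (key<K h≡) ⟩
    1                                       ∎))

  hit≤1 : ∀ b u v → hit b u v ≤ 1
  hit≤1 b u v = *-mono-≤ (𝟙≤1 (toℕ b ≡ᵇ key u v)) (h≤1 u v)

  hit-positive : ∀ b {u v} → 1 ≤ hit b u v → toℕ b ≡ key u v × h u v ≡ 1
  hit-positive b {u} {v} p with 𝟙*-positive (toℕ b ≡ᵇ key u v) (h u v) p
  ... | b≡key , 1≤h = ≡ᵇ⇒≡ (toℕ b) (key u v) b≡key , ≤-antisym (h≤1 u v) 1≤h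

  hit-unique : ∀ b {u v u′ v′} → 1 ≤ hit b u v → 1 ≤ hit b u′ v′ → u ≡ u′ × v ≡ v′
  hit-unique b p q with hit-positive b p | hit-positive b q
  ... | b≡k , h≡1 | b≡k′ , h′≡1 = key-injective h≡1 h′≡1 (trans (sym b≡k) b≡k′)

sum-tabulate : ∀ {n} (f : Fin n → ℕ) → List.sum (tabulate f) ≡ ∑[ i < n ] f i
sum-tabulate {zero}  f = refl
sum-tabulate {suc n} f = cong (f zero +_) (sum-tabulate (f ∘ suc))

sum-map-allFin : ∀ n (f : Fin n → ℕ) → List.sum (map f (allFin n)) ≡ ∑[ i < n ] f i
sum-map-allFin n f = trans (cong List.sum (Listₚ.map-tabulate (λ i → i) f)) (sum-tabulate f)

sum-concatMap : ∀ {A : Set} (g : A → List ℕ) xs →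
  List.sum (concatMap g xs) ≡ List.sum (map (List.sum ∘ g) xs)
sum-concatMap g []       = refl
sum-concatMap g (x ∷ xs) =
  trans (List.sum-++ (g x) (concatMap g xs)) (cong (List.sum (g x) +_) (sum-concatMap g xs))

C2-suc : ∀ n → suc n C 2 ≡ n + n C 2
C2-suc n = trans (sym (nCk+nC[k+1]≡[n+1]C[k+1] n 1)) (cong (_+ n C 2) (nC1≡n n))

C2-mono : ∀ {m n} → m ≤ n → m C 2 ≤ n C 2
C2-mono {n = n} z≤n = z≤n
C2-mono {suc m} {suc n} (s≤s m≤n) rewrite C2-suc m | C2-suc n = +-mono-≤ m≤n (C2-mono m≤n)

C2-double : ∀ n → 2 * (n C 2) + n ≡ n * n
C2-double zero    = refl
C2-double (suc n) = begin
  2 * (suc n C 2) + suc n             ≡⟨ cong (λ c → 2 * c + suc n) (C2-suc n) ⟩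
  2 * (n + n C 2) + suc n             ≡⟨ regroup n (n C 2) ⟩
  (2 * (n C 2) + n) + suc (n + n)     ≡⟨ cong (_+ suc (n + n)) (C2-double n) ⟩
  n * n + suc (n + n)                 ≡⟨ square n ⟩
  suc n * suc n                       ∎
  where
  open ≡-Reasoning
  regroup : ∀ n c → 2 * (n + c) + suc n ≡ (2 * c + n) + suc (n + n)
  regroup = solve-∀
  square : ∀ n → n * n + suc (n + n) ≡ suc n * suc n
  square = solve-∀

C2-suc-double : ∀ d → 2 * (suc d C 2) ≡ d * suc d
C2-suc-double d = begin
  2 * (suc d C 2)          ≡⟨ cong (2 *_) (C2-suc d) ⟩
  2 * (d + d C 2)          ≡⟨ regroup d (d C 2) ⟩
  d + (2 * (d C 2) + d)    ≡⟨ cong (d +_) (C2-double d) ⟩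
  d + d * d                ≡⟨ sym (*-suc d d) ⟩
  d * suc d                ∎
  where
  open ≡-Reasoning
  regroup : ∀ d c → 2 * (d + c) ≡ d + (2 * c + d)
  regroup = solve-∀

C2-+ : ∀ p t → (p + t) C 2 ≡ p C 2 + t * p + t C 2
C2-+ p zero    = trans (cong (_C 2) (+-identityʳ p)) (sym (trans (+-identityʳ _) (+-identityʳ _)))
C2-+ p (suc t) = begin
  (p + suc t) C 2                         ≡⟨ cong (_C 2) (+-suc p t) ⟩
  suc (p + t) C 2                         ≡⟨ C2-suc (p + t) ⟩
  p + t + (p + t) C 2                     ≡⟨ cong (p + t +_) (C2-+ p t) ⟩
  p + t + (p C 2 + t * p + t C 2)         ≡⟨ regroup p t (p C 2) (t C 2) ⟩
  p C 2 + suc t * p + (t + t C 2)         ≡⟨ cong (p C 2 + suc t * p +_) (sym (C2-suc t)) ⟩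
  p C 2 + suc t * p + suc t C 2           ∎
  where
  open ≡-Reasoning
  regroup : ∀ p t a b → p + t + (a + t * p + b) ≡ a + suc t * p + (t + b)
  regroup = solve-∀

-- For lo < hi, hi C 2 + lo is the position of {lo, hi} when pairs are listed by their larger element.
pair-code-< : ∀ {lo hi} → lo < hi → hi C 2 + lo < suc hi C 2
pair-code-< {lo} {hi} lo<hi rewrite C2-suc hi =
  subst (hi C 2 + lo <_) (+-comm (hi C 2) hi) (+-monoʳ-< (hi C 2) lo<hi)

pair-code-mono : ∀ {lo hi lo′ hi′} → lo < hi → hi < hi′ → hi C 2 + lo < hi′ C 2 + lo′
pair-code-mono {lo′ = lo′} lo<hi hi<hi′ =
  <-≤-trans (pair-code-< lo<hi) (≤-trans (C2-mono hi<hi′) (m≤m+n _ lo′))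

pair-code-injective : ∀ {lo hi lo′ hi′} → lo < hi → lo′ < hi′ →
  hi C 2 + lo ≡ hi′ C 2 + lo′ → lo ≡ lo′ × hi ≡ hi′
pair-code-injective {lo} {hi} {lo′} {hi′} lo<hi lo′<hi′ same with <-cmp hi hi′
... | tri≈ _ refl _  = +-cancelˡ-≡ (hi C 2) lo lo′ same , refl
... | tri< hi<hi′ _ _ = contradiction same       (<⇒≢ (pair-code-mono lo<hi hi<hi′))
... | tri> _ _ hi′<hi = contradiction (sym same) (<⇒≢ (pair-code-mono lo′<hi′ hi′<hi))

pair-decode : ∀ n y → y < n C 2 → ∃ λ lo → ∃ λ hi → lo < hi × hi < n × hi C 2 + lo ≡ y
pair-decode (suc n) y y<C with y <? n C 2
... | yes y<nC2 with pair-decode n y y<nC2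
...   | lo , hi , lo<hi , hi<n , code≡y = lo , hi , lo<hi , m<n⇒m<1+n hi<n , code≡y
pair-decode (suc n) y y<C | no y≮nC2 =
  y ∸ n C 2 , n , lo<n , n<1+n n , m+[n∸m]≡n (≮⇒≥ y≮nC2)
  where
  lo<n : y ∸ n C 2 < n
  lo<n = +-cancelʳ-< (n C 2) (y ∸ n C 2) n
           (subst₂ _<_ (sym (m∸n+n≡m (≮⇒≥ y≮nC2))) (C2-suc n) y<C)

Labelling : ℕ → Set
Labelling n = Fin n → Fin n

classSize : ∀ {n} → Labelling n → Fin n → ℕ
classSize {n} r w = ∑[ u < n ] δ (r u) w

-- n minus the number of classes: an empty class contributes 0 ∸ 1 = 0.
excess : ∀ {n} → Labelling n → ℕ
excess {n} r = ∑[ w < n ] (classSize r w ∸ 1)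

excess-cong : ∀ {n} {r r′ : Labelling n} → (∀ z → r z ≡ r′ z) → excess r ≡ excess r′
excess-cong r≗r′ = sum-cong-≗ (λ w → cong (_∸ 1) (sum-cong-≗ (λ u → cong (λ c → δ c w) (r≗r′ u))))

excess-id : ∀ {n} → excess {n} (λ z → z) ≡ 0
excess-id {n} = trans (sum-cong-≗ (λ w → cong (_∸ 1) (∑-δ-count {n} w))) (sum-replicate-zero n)

∑-classSize : ∀ {n} (r : Labelling n) → ∑[ w < n ] classSize r w ≡ n
∑-classSize {n} r = begin
  ∑[ w < n ] ∑[ u < n ] δ (r u) w  ≡⟨ ∑-comm (λ w u → δ (r u) w) ⟩
  ∑[ u < n ] ∑[ w < n ] δ (r u) w  ≡⟨ sum-cong-≗ (λ u → trans (sum-cong-≗ (δ-sym (r u))) (∑-δ-count (r u))) ⟩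
  ∑[ u < n ] 1                     ≡⟨ ∑-const n 1 ⟩
  n * 1                            ≡⟨ *-identityʳ n ⟩
  n                                ∎
  where open ≡-Reasoning

∑∑-sameClass : ∀ {n} (r : Labelling n) →
  ∑[ u < n ] ∑[ v < n ] δ (r u) (r v) ≡ ∑[ w < n ] (classSize r w * classSize r w)
∑∑-sameClass {n} r = begin
  ∑[ u < n ] ∑[ v < n ] δ (r u) (r v)                ≡⟨ sum-cong-≗ (λ u → sum-cong-≗ (λ v → δ-sym (r u) (r v))) ⟩
  ∑[ u < n ] classSize r (r u)                       ≡⟨ sum-cong-≗ (λ u → sym (∑-δ (classSize r) (r u))) ⟩
  ∑[ u < n ] ∑[ w < n ] (δ w (r u) * classSize r w)  ≡⟨ ∑-comm (λ u w → δ w (r u) * classSize r w) ⟩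
  ∑[ w < n ] ∑[ u < n ] (δ w (r u) * classSize r w)  ≡⟨ sum-cong-≗ (λ w → ∑-*ʳ (λ u → δ w (r u)) (classSize r w)) ⟩
  ∑[ w < n ] ((∑[ u < n ] δ w (r u)) * classSize r w) ≡⟨ sum-cong-≗ (λ w → cong (_* classSize r w) (sum-cong-≗ (λ u → δ-sym w (r u)))) ⟩
  ∑[ w < n ] (classSize r w * classSize r w)         ∎
  where open ≡-Reasoning

relabel : ∀ {n} → Labelling n → Fin n → Fin n → Labelling n
relabel r x y z = if does (r z Fin.≟ r y) then r x else r z

module _ {n} (r : Labelling n) (x y : Fin n) (rx≢ry : r x ≢ r y) where

  private
    a = r x
    b = r y
    size  = classSize r
    size′ = classSize (relabel r x y)

  classSize-relabel-old : size′ b ≡ 0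
  classSize-relabel-old = trans (sum-cong-≗ moved) (sum-replicate-zero n)
    where
    moved : ∀ u → δ (relabel r x y u) b ≡ 0
    moved u with r u Fin.≟ b
    ... | yes _   = δ-≢ rx≢ry
    ... | no ru≢b = δ-≢ ru≢b

  classSize-relabel : ∀ {w} → w ≢ b → size′ w ≡ size w + size b * δ w a
  classSize-relabel {w} w≢b = begin
    ∑[ u < n ] δ (relabel r x y u) w                  ≡⟨ sum-cong-≗ split ⟩
    ∑[ u < n ] (δ (r u) w + δ (r u) b * δ w a)        ≡⟨ ∑-distrib-+ (λ u → δ (r u) w) _ ⟩
    size w + ∑[ u < n ] (δ (r u) b * δ w a)           ≡⟨ cong (size w +_) (∑-*ʳ (λ u → δ (r u) b) (δ w a)) ⟩
    size w + size b * δ w a                           ∎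
    where
    open ≡-Reasoning
    split : ∀ u → δ (relabel r x y u) w ≡ δ (r u) w + δ (r u) b * δ w a
    split u with r u Fin.≟ b
    ... | yes ru≡b = let ru≢w = λ ru≡w → w≢b (trans (sym ru≡w) ru≡b) in begin
      δ a w                   ≡⟨ δ-sym a w ⟩
      δ w a                   ≡⟨ sym (+-identityʳ _) ⟩
      δ w a + 0               ≡⟨ cong₂ _+_ (sym (*-identityˡ (δ w a))) (sym (δ-≢ ru≢w)) ⟩
      1 * δ w a + δ (r u) w   ≡⟨ +-comm _ (δ (r u) w) ⟩
      δ (r u) w + 1 * δ w a   ∎
    ... | no _ = sym (+-identityʳ _)

  private
    m+n∸1≤m∸1+n : ∀ m n → m + n ∸ 1 ≤ (m ∸ 1) + n
    m+n∸1≤m∸1+n zero    n = m∸n≤m n 1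
    m+n∸1≤m∸1+n (suc m) n = ≤-refl

    excess-step : ∀ w → (size′ w ∸ 1) + δ w b * (size b ∸ 1) ≤ (size w ∸ 1) + δ w a * size b
    excess-step w with w Fin.≟ b
    ... | yes refl rewrite classSize-relabel-old | δ-≢ {x = b} {a} (rx≢ry ∘ sym) = ≤-refl
    ... | no w≢b rewrite classSize-relabel w≢b with w Fin.≟ a
    ...   | yes refl = begin
      size a + size b * 1 ∸ 1 + 0       ≡⟨ +-identityʳ _ ⟩
      size a + size b * 1 ∸ 1           ≡⟨ cong (λ t → size a + t ∸ 1) (*-identityʳ (size b)) ⟩
      size a + size b ∸ 1               ≤⟨ m+n∸1≤m∸1+n (size a) (size b) ⟩
      (size a ∸ 1) + size b             ≡⟨ cong (size a ∸ 1 +_) (sym (*-identityˡ (size b))) ⟩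
      (size a ∸ 1) + 1 * size b         ∎
      where open ≤-Reasoning
    ...   | no _ = ≤-reflexive (cong (λ t → t ∸ 1 + 0) (trans (cong (size w +_) (*-zeroʳ (size b))) (+-identityʳ _)))

  excess-relabel-distinct : excess (relabel r x y) ≤ suc (excess r)
  excess-relabel-distinct = +-cancelʳ-≤ (size b ∸ 1) _ _ (begin
    excess (relabel r x y) + (size b ∸ 1)                            ≡⟨ cong (excess (relabel r x y) +_) (sym (∑-δ (λ _ → size b ∸ 1) b)) ⟩
    excess (relabel r x y) + ∑[ w < n ] (δ w b * (size b ∸ 1))       ≡⟨ sym (∑-distrib-+ (λ w → size′ w ∸ 1) _) ⟩
    ∑[ w < n ] ((size′ w ∸ 1) + δ w b * (size b ∸ 1))                ≤⟨ ∑-mono-≤ excess-step ⟩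
    ∑[ w < n ] ((size w ∸ 1) + δ w a * size b)                       ≡⟨ ∑-distrib-+ (λ w → size w ∸ 1) _ ⟩
    excess r + ∑[ w < n ] (δ w a * size b)                           ≡⟨ cong (excess r +_) (∑-δ (λ _ → size b) a) ⟩
    excess r + size b                                                ≤⟨ +-monoʳ-≤ (excess r) (m≤n+m∸n (size b) 1) ⟩
    excess r + suc (size b ∸ 1)                                      ≡⟨ +-suc (excess r) _ ⟩
    suc (excess r) + (size b ∸ 1)                                    ∎)
    where open ≤-Reasoning

excess-relabel : ∀ {n} (r : Labelling n) x y → excess (relabel r x y) ≤ suc (excess r)
excess-relabel r x y with r x Fin.≟ r y
... | no rx≢ry  = excess-relabel-distinct r x y rx≢ry
... | yes rx≡ry = ≤-trans (≤-reflexive (excess-cong unchanged)) (n≤1+n _)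
  where
  unchanged : ∀ z → relabel r x y z ≡ r z
  unchanged z with r z Fin.≟ r y
  ... | yes rz≡ry = trans rx≡ry (sym rz≡ry)
  ... | no _      = refl

relabel-joins : ∀ {n} (r : Labelling n) x y → relabel r x y x ≡ relabel r x y y
relabel-joins r x y with r x Fin.≟ r y | r y Fin.≟ r y
... | _ | no ry≢ry = contradiction refl ry≢ry
... | yes _ | yes _ = refl
... | no _  | yes _ = refl

relabel-preserves : ∀ {n} (r : Labelling n) x y {p q} → r p ≡ r q → relabel r x y p ≡ relabel r x y q
relabel-preserves r x y rp≡rq rewrite rp≡rq = refl

-- Union–find along the relation E: every pair is scanned and the classes of u and v are merged
-- when E u v holds; each merge raises the excess by at most one.
module Components {n} (E : Fin n → Fin n → Bool) where

  mergeIf : Bool → Fin n → Fin n → Labelling n → Labelling n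
  mergeIf true  x y r = relabel r x y
  mergeIf false x y r = r

  mergeRow : Fin n → List (Fin n) → Labelling n → Labelling n
  mergeRow u []       r = r
  mergeRow u (v ∷ vs) r = mergeRow u vs (mergeIf (E u v) u v r)

  mergeRows : List (Fin n) → Labelling n → Labelling n
  mergeRows []       r = r
  mergeRows (u ∷ us) r = mergeRows us (mergeRow u (allFin n) r)

  component : Labelling n
  component = mergeRows (allFin n) (λ z → z)

  mergeIf-preserves : ∀ b x y r {p q} → r p ≡ r q → mergeIf b x y r p ≡ mergeIf b x y r q
  mergeIf-preserves true  x y r = relabel-preserves r x y
  mergeIf-preserves false x y r = λ rp≡rq → rp≡rq

  mergeRow-preserves : ∀ u vs r {p q} → r p ≡ r q → mergeRow u vs r p ≡ mergeRow u vs r q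
  mergeRow-preserves u []       r = λ rp≡rq → rp≡rq
  mergeRow-preserves u (v ∷ vs) r = mergeRow-preserves u vs _ ∘ mergeIf-preserves (E u v) u v r

  mergeRows-preserves : ∀ us r {p q} → r p ≡ r q → mergeRows us r p ≡ mergeRows us r q
  mergeRows-preserves []       r = λ rp≡rq → rp≡rq
  mergeRows-preserves (u ∷ us) r = mergeRows-preserves us _ ∘ mergeRow-preserves u (allFin n) r

  mergeRow-joins : ∀ {u v} vs r → E u v ≡ true → v ∈ vs → mergeRow u vs r u ≡ mergeRow u vs r v
  mergeRow-joins {u} {v} (v ∷ vs) r Euv (here refl) rewrite Euv =
    mergeRow-preserves u vs _ (relabel-joins r u v)
  mergeRow-joins (w ∷ vs) r Euv (there v∈vs) = mergeRow-joins vs _ Euv v∈vs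

  mergeRows-joins : ∀ {u v} us r → E u v ≡ true → u ∈ us → mergeRows us r u ≡ mergeRows us r v
  mergeRows-joins {u} {v} (u ∷ us) r Euv (here refl) =
    mergeRows-preserves us _ (mergeRow-joins (allFin n) r Euv (∈-allFin v))
  mergeRows-joins (w ∷ us) r Euv (there u∈us) = mergeRows-joins us _ Euv u∈us

  component-joins : ∀ {u v} → E u v ≡ true → component u ≡ component v
  component-joins {u} Euv = mergeRows-joins (allFin n) _ Euv (∈-allFin u)

  excess-mergeIf : ∀ b x y r → excess (mergeIf b x y r) ≤ 𝟙 b + excess r
  excess-mergeIf true  x y r = excess-relabel r x y
  excess-mergeIf false x y r = ≤-refl

  rowCount : Fin n → List (Fin n) → ℕ
  rowCount u vs = List.sum (map (λ v → 𝟙 (E u v)) vs)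

  excess-mergeRow : ∀ u vs r → excess (mergeRow u vs r) ≤ excess r + rowCount u vs
  excess-mergeRow u []       r = m≤m+n _ 0
  excess-mergeRow u (v ∷ vs) r = begin
    excess (mergeRow u vs (mergeIf (E u v) u v r))            ≤⟨ excess-mergeRow u vs _ ⟩
    excess (mergeIf (E u v) u v r) + rowCount u vs            ≤⟨ +-monoˡ-≤ _ (excess-mergeIf (E u v) u v r) ⟩
    𝟙 (E u v) + excess r + rowCount u vs                      ≡⟨ cong (_+ rowCount u vs) (+-comm (𝟙 (E u v)) _) ⟩
    excess r + 𝟙 (E u v) + rowCount u vs                      ≡⟨ +-assoc (excess r) _ _ ⟩
    excess r + rowCount u (v ∷ vs)                            ∎
    where open ≤-Reasoning

  excess-mergeRows : ∀ us r →
    excess (mergeRows us r) ≤ excess r + List.sum (map (λ u → rowCount u (allFin n)) us)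
  excess-mergeRows []       r = m≤m+n _ 0
  excess-mergeRows (u ∷ us) r = begin
    excess (mergeRows us (mergeRow u (allFin n) r))          ≤⟨ excess-mergeRows us _ ⟩
    excess (mergeRow u (allFin n) r) + rest                  ≤⟨ +-monoˡ-≤ rest (excess-mergeRow u (allFin n) r) ⟩
    excess r + rowCount u (allFin n) + rest                  ≡⟨ +-assoc (excess r) _ _ ⟩
    excess r + (rowCount u (allFin n) + rest)                ∎
    where
    open ≤-Reasoning
    rest = List.sum (map (λ u → rowCount u (allFin n)) us)

  excess-component : excess component ≤ ∑[ u < n ] ∑[ v < n ] 𝟙 (E u v)
  excess-component = begin
    excess component                                                   ≤⟨ excess-mergeRows (allFin n) (λ z → z) ⟩
    excess {n} (λ z → z) + List.sum (map (λ u → rowCount u (allFin n)) (allFin n))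
      ≡⟨ cong₂ _+_ (excess-id {n}) (sum-map-allFin n _) ⟩
    ∑[ u < n ] rowCount u (allFin n)                                   ≡⟨ sum-cong-≗ (λ u → sum-map-allFin n (λ v → 𝟙 (E u v))) ⟩
    ∑[ u < n ] ∑[ v < n ] 𝟙 (E u v)                                    ∎
    where open ≤-Reasoning

edgeIndicator : ∀ {n} → Graph n → Fin n → Fin n → ℕ
edgeIndicator G u v = 𝟙 ((toℕ u <ᵇ toℕ v) ∧ adj G u v)

edgeCount≡∑∑ : ∀ {n} (G : Graph n) → edgeCount G ≡ ∑[ u < n ] ∑[ v < n ] edgeIndicator G u v
edgeCount≡∑∑ {n} G = begin
  List.sum (concatMap (λ u → map (edgeIndicator G u) (allFin n)) (allFin n))  ≡⟨ sum-concatMap _ (allFin n) ⟩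
  List.sum (map (λ u → List.sum (map (edgeIndicator G u) (allFin n))) (allFin n))
    ≡⟨ sum-map-allFin n _ ⟩
  ∑[ u < n ] List.sum (map (edgeIndicator G u) (allFin n))                     ≡⟨ sum-cong-≗ (λ u → sum-map-allFin n (edgeIndicator G u)) ⟩
  ∑[ u < n ] ∑[ v < n ] edgeIndicator G u v                                    ∎
  where open ≡-Reasoning

edge-oriented : ∀ {n} (G : Graph n) {u v} → adj G u v ≡ true →
  ((toℕ u <ᵇ toℕ v) ∧ adj G u v ≡ true) ⊎ ((toℕ v <ᵇ toℕ u) ∧ adj G v u ≡ true)
edge-oriented G {u} {v} uv with <-cmp (toℕ u) (toℕ v)
... | tri< u<v _ _ rewrite uv = inj₁ (cong (_∧ true) (to T-≡ (<⇒<ᵇ u<v)))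
... | tri≈ _ u≡v _ rewrite Fin.toℕ-injective u≡v | irrefl G v = contradiction uv λ ()
... | tri> _ _ v<u rewrite Graph.sym G v u | uv = inj₂ (cong (_∧ true) (to T-≡ (<⇒<ᵇ v<u)))

MonoWalk⇒Walk : ∀ {n} {G : Graph n} {j} {c : EdgeColoring G j} {a u v} → MonoWalk G c a u v → Walk G u v
MonoWalk⇒Walk here            = here
MonoWalk⇒Walk (step e _ walk) = step e (MonoWalk⇒Walk walk)

module ColourClasses {n} {G : Graph n} {j} (c : EdgeColoring G j) where

  colourEdge : Fin j → Fin n → Fin n → Bool
  colourEdge a u v = ((toℕ u <ᵇ toℕ v) ∧ adj G u v) ∧ does (col c u v Fin.≟ a)

  colourCount : Fin j → ℕ
  colourCount a = ∑[ u < n ] ∑[ v < n ] 𝟙 (colourEdge a u v)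

  ∑-colourCount : ∑[ a < j ] colourCount a ≡ edgeCount G
  ∑-colourCount = begin
    ∑[ a < j ] ∑[ u < n ] ∑[ v < n ] 𝟙 (colourEdge a u v)  ≡⟨ ∑-comm (λ a u → ∑[ v < n ] 𝟙 (colourEdge a u v)) ⟩
    ∑[ u < n ] ∑[ a < j ] ∑[ v < n ] 𝟙 (colourEdge a u v)  ≡⟨ sum-cong-≗ (λ u → ∑-comm (λ a v → 𝟙 (colourEdge a u v))) ⟩
    ∑[ u < n ] ∑[ v < n ] ∑[ a < j ] 𝟙 (colourEdge a u v)  ≡⟨ sum-cong-≗ (λ u → sum-cong-≗ (one-colour u)) ⟩
    ∑[ u < n ] ∑[ v < n ] edgeIndicator G u v              ≡⟨ sym (edgeCount≡∑∑ G) ⟩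
    edgeCount G                                            ∎
    where
    open ≡-Reasoning
    one-colour : ∀ u v → ∑[ a < j ] 𝟙 (colourEdge a u v) ≡ edgeIndicator G u v
    one-colour u v with (toℕ u <ᵇ toℕ v) ∧ adj G u v
    ... | false = sum-replicate-zero j
    ... | true  = trans (sum-cong-≗ (δ-sym (col c u v))) (∑-δ-count (col c u v))

  colourEdge-of-edge : ∀ {a u v} → adj G u v ≡ true → col c u v ≡ a →
                       colourEdge a u v ≡ true ⊎ colourEdge a v u ≡ true
  colourEdge-of-edge {a} {u} {v} uv col≡a with edge-oriented G uv
  ... | inj₁ u<v rewrite u<v | col≡a = inj₁ (dec-true (a Fin.≟ a) refl)
  ... | inj₂ v<u rewrite v<u | sym (colSym c u v uv) | col≡a = inj₂ (dec-true (a Fin.≟ a) refl)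

  private
    1≤colourCount : ∀ {a} u v → colourEdge a u v ≡ true → 1 ≤ colourCount a
    1≤colourCount {a} u v e =
      ≤-trans (≤-reflexive (cong 𝟙 (sym e)))
              (≤-trans (term≤∑ (λ v → 𝟙 (colourEdge a u v)) v)
                       (term≤∑ (λ u → ∑[ v < n ] 𝟙 (colourEdge a u v)) u))

  colourCount-positive : UsesAll c → ∀ a → 1 ≤ colourCount a
  colourCount-positive uses a with uses a
  ... | u , v , uv , col≡a with colourEdge-of-edge uv col≡a
  ...   | inj₁ e = 1≤colourCount u v e
  ...   | inj₂ e = 1≤colourCount v u e

  component : Fin j → Labelling n
  component a = Components.component (colourEdge a)

  component-walk : ∀ {a u v} → MonoWalk G c a u v → component a u ≡ component a v
  component-walk here = refl
  component-walk {a} (step uw col≡a walk) with colourEdge-of-edge uw col≡a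
  ... | inj₁ e = trans (Components.component-joins (colourEdge a) e) (component-walk walk)
  ... | inj₂ e = trans (sym (Components.component-joins (colourEdge a) e)) (component-walk walk)

  sameComponent : Fin j → Fin n → Fin n → ℕ
  sameComponent a u v = δ (component a u) (component a v)

  ∑∑-sameComponent≤ : ∀ a →
    ∑[ u < n ] ∑[ v < n ] sameComponent a u v ≤ n + colourCount a * suc (colourCount a)
  ∑∑-sameComponent≤ a = begin
    ∑[ u < n ] ∑[ v < n ] sameComponent a u v                  ≡⟨ ∑∑-sameClass (component a) ⟩
    ∑[ w < n ] (size w * size w)                               ≤⟨ ∑-square≤ size ⟩
    ∑[ w < n ] size w + excess (component a) * suc (excess (component a))
      ≤⟨ +-mono-≤ (≤-reflexive (∑-classSize (component a))) (*-mono-≤ e≤count (s≤s e≤count)) ⟩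
    n + colourCount a * suc (colourCount a)                    ∎
    where
    open ≤-Reasoning
    size = classSize (component a)
    e≤count = Components.excess-component (colourEdge a)

  -- IsMC puts every pair u ≢ v in a common component of some colour; the diagonal is counted once per colour.
  pair-covered : IsMC c → ∀ u v → 1 + δ u v * j ≤ ∑[ a < j ] sameComponent a u v + δ u v
  pair-covered mc u v with u Fin.≟ v
  ... | yes refl = ≤-reflexive (begin-equality
    1 + 1 * j                             ≡⟨ +-comm 1 (1 * j) ⟩
    1 * j + 1                             ≡⟨ cong (_+ 1) (*-comm 1 j) ⟩
    j * 1 + 1                             ≡⟨ cong (_+ 1) (sym (∑-const j 1)) ⟩
    ∑[ a < j ] 1 + 1                      ≡⟨ cong (_+ 1) (sum-cong-≗ (λ a → sym (δ-refl (component a u)))) ⟩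
    ∑[ a < j ] sameComponent a u u + 1    ∎)
    where open ≤-Reasoning
  ... | no _ with mc u v
  ...   | a , walk = +-monoˡ-≤ 0 (≤-trans (≤-reflexive (sym sameA)) (term≤∑ (λ a → sameComponent a u v) a))
    where
    sameA : sameComponent a u v ≡ 1
    sameA = trans (cong (δ (component a u)) (sym (component-walk walk))) (δ-refl (component a u))

  private
    ∑∑-by-colour : ∑[ u < n ] ∑[ v < n ] (∑[ a < j ] sameComponent a u v + δ u v)
                 ≡ ∑[ a < j ] ∑[ u < n ] ∑[ v < n ] sameComponent a u v + n
    ∑∑-by-colour = begin
      ∑[ u < n ] ∑[ v < n ] (∑[ a < j ] sameComponent a u v + δ u v)
        ≡⟨ sum-cong-≗ (λ u → ∑-distrib-+ (λ v → ∑[ a < j ] sameComponent a u v) (δ u)) ⟩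
      ∑[ u < n ] (∑[ v < n ] ∑[ a < j ] sameComponent a u v + ∑[ v < n ] δ u v)
        ≡⟨ ∑-distrib-+ (λ u → ∑[ v < n ] ∑[ a < j ] sameComponent a u v) (λ u → ∑[ v < n ] δ u v) ⟩
      ∑[ u < n ] ∑[ v < n ] ∑[ a < j ] sameComponent a u v + ∑[ u < n ] ∑[ v < n ] δ u v
        ≡⟨ cong₂ _+_ swap (trans (sum-cong-≗ (λ u → trans (sum-cong-≗ (δ-sym u)) (∑-δ-count {n} u)))
                                 (trans (∑-const n 1) (*-identityʳ n))) ⟩
      ∑[ a < j ] ∑[ u < n ] ∑[ v < n ] sameComponent a u v + n
        ∎
      where
      open ≡-Reasoning
      swap : ∑[ u < n ] ∑[ v < n ] ∑[ a < j ] sameComponent a u v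
           ≡ ∑[ a < j ] ∑[ u < n ] ∑[ v < n ] sameComponent a u v
      swap = trans (sum-cong-≗ (λ u → ∑-comm (λ v a → sameComponent a u v)))
                   (∑-comm (λ u a → ∑[ v < n ] sameComponent a u v))

  vertexPairs≤ : IsMC c → n * n ≤ n + ∑[ a < j ] (colourCount a * suc (colourCount a))
  vertexPairs≤ mc = +-cancelʳ-≤ (j * n) _ _ (begin
    n * n + j * n                                                       ≡⟨ sym (∑∑-1+δ* n j) ⟩
    ∑[ u < n ] ∑[ v < n ] (1 + δ u v * j)                               ≤⟨ ∑-mono-≤ (λ u → ∑-mono-≤ (pair-covered mc u)) ⟩
    ∑[ u < n ] ∑[ v < n ] (∑[ a < j ] sameComponent a u v + δ u v)      ≡⟨ ∑∑-by-colour ⟩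
    ∑[ a < j ] ∑[ u < n ] ∑[ v < n ] sameComponent a u v + n            ≤⟨ +-monoˡ-≤ n (∑-mono-≤ ∑∑-sameComponent≤) ⟩
    ∑[ a < j ] (n + colourCount a * suc (colourCount a)) + n
      ≡⟨ cong (_+ n) (trans (∑-distrib-+ {j} (λ _ → n) (λ a → colourCount a * suc (colourCount a)))
                            (cong (_+ X) (∑-const j n))) ⟩
    j * n + X + n                                                       ≡⟨ rearrange (j * n) X n ⟩
    n + X + j * n                                                       ∎)
    where
    open ≤-Reasoning
    X = ∑[ a < j ] (colourCount a * suc (colourCount a))
    rearrange : ∀ a b c → a + b + c ≡ c + b + a
    rearrange = solve-∀

  colourExcess : ℕ
  colourExcess = ∑[ a < j ] (colourCount a ∸ 1)

  colourExcess+j : UsesAll c → colourExcess + j ≡ edgeCount G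
  colourExcess+j uses = begin
    colourExcess + j                                   ≡⟨ cong (colourExcess +_) (sym (trans (∑-const j 1) (*-identityʳ j))) ⟩
    colourExcess + ∑[ a < j ] 1                        ≡⟨ sym (∑-distrib-+ (λ a → colourCount a ∸ 1) (λ _ → 1)) ⟩
    ∑[ a < j ] (colourCount a ∸ 1 + 1)                 ≡⟨ sum-cong-≗ (λ a → m∸n+n≡m (colourCount-positive uses a)) ⟩
    ∑[ a < j ] colourCount a                           ≡⟨ ∑-colourCount ⟩
    edgeCount G                                        ∎
    where open ≡-Reasoning

  vertexPairs≤-edges : UsesAll c → IsMC c →
    n * n ≤ n + (edgeCount G + (edgeCount G + (edgeCount G ∸ j) * suc (edgeCount G ∸ j)))
  vertexPairs≤-edges uses mc = begin
    n * n                                                            ≤⟨ vertexPairs≤ mc ⟩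
    n + ∑[ a < j ] (colourCount a * suc (colourCount a))             ≡⟨ cong (n +_) (sum-cong-≗ (λ a → *-suc (colourCount a) _)) ⟩
    n + ∑[ a < j ] (colourCount a + colourCount a * colourCount a)   ≡⟨ cong (n +_) (∑-distrib-+ colourCount _) ⟩
    n + (∑[ a < j ] colourCount a + ∑[ a < j ] (colourCount a * colourCount a))
      ≤⟨ +-monoʳ-≤ n (+-monoʳ-≤ (∑[ a < j ] colourCount a) (∑-square≤ colourCount)) ⟩
    n + (∑[ a < j ] colourCount a + (∑[ a < j ] colourCount a + D * suc D))
      ≡⟨ cong (λ s → n + (s + (s + D * suc D))) ∑-colourCount ⟩
    n + (m + (m + D * suc D))                                        ≡⟨ cong (λ d → n + (m + (m + d * suc d))) D≡m∸j ⟩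
    n + (m + (m + (m ∸ j) * suc (m ∸ j)))                            ∎
    where
    open ≤-Reasoning
    m = edgeCount G
    D = colourExcess
    D≡m∸j : D ≡ m ∸ j
    D≡m∸j = trans (sym (m+n∸n≡m D j)) (cong (_∸ j) (colourExcess+j uses))

colours≤edges : ∀ {n} {G : Graph n} {j} (c : EdgeColoring G j) → UsesAll c → j ≤ edgeCount G
colours≤edges c uses = ≤-trans (m≤n+m _ _) (≤-reflexive (ColourClasses.colourExcess+j c uses))

pairs≤edges+C2 : ∀ {n} {G : Graph n} {j} (c : EdgeColoring G j) → UsesAll c → IsMC c →
           n C 2 ≤ edgeCount G + suc (edgeCount G ∸ j) C 2
pairs≤edges+C2 {n} {G} {j} c uses mc = *-cancelˡ-≤ 2 (+-cancelˡ-≤ n _ _ (begin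
  n + 2 * (n C 2)                              ≡⟨ +-comm n _ ⟩
  2 * (n C 2) + n                              ≡⟨ C2-double n ⟩
  n * n                                        ≤⟨ ColourClasses.vertexPairs≤-edges c uses mc ⟩
  n + (m + (m + D * suc D))                    ≡⟨ cong (λ t → n + (m + (m + t))) (sym (C2-suc-double D)) ⟩
  n + (m + (m + 2 * (suc D C 2)))              ≡⟨ cong (n +_) (regroup m (suc D C 2)) ⟩
  n + 2 * (m + suc D C 2)                      ∎))
  where
  open ≤-Reasoning
  m = edgeCount G
  D = m ∸ j
  regroup : ∀ m c → m + (m + 2 * c) ≡ 2 * (m + c)
  regroup = solve-∀

GoodBound-mono : ∀ {n k m m′} → m′ ≤ m → GoodBound n k m → GoodBound n k m′
GoodBound-mono m′≤m good G connected few = good G connected (≤-trans few m′≤m)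

goodBound-by-counting : ∀ n k M → M + (M ∸ k) C 2 < n C 2 → GoodBound n k M
goodBound-by-counting n k M bound G _ m≤M j c uses mc with j ≤? k
... | yes j≤k = j≤k
... | no  j≰k = contradiction (pairs≤edges+C2 c uses mc) (<⇒≱ (≤-<-trans (+-mono-≤ m≤M (C2-mono fewer)) bound))
  where
  m = edgeCount G
  k<j = ≰⇒> j≰k
  fewer : suc (m ∸ j) ≤ M ∸ k
  fewer = begin
    suc (m ∸ j)        ≤⟨ s≤s (∸-monoʳ-≤ m k<j) ⟩
    suc (m ∸ suc k)    ≡⟨ sym (+-∸-assoc 1 (≤-trans k<j (colours≤edges c uses))) ⟩
    m ∸ k              ≤⟨ ∸-monoˡ-≤ k m≤M ⟩
    M ∸ k              ∎
    where open ≤-Reasoning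

GoodBound⇒≤ : ∀ {n k v} → ¬ GoodBound n k (suc v) → ∀ m → GoodBound n k m → m ≤ v
GoodBound⇒≤ {v = v} bad m good with m ≤? v
... | yes m≤v = m≤v
... | no  m≰v = contradiction (GoodBound-mono (≰⇒> m≰v) good) bad

-- Saturates at k; it is only applied to values that are at most k.
clamp : ∀ {k} → ℕ → Fin (suc k)
clamp         zero    = zero
clamp {zero}  (suc _) = zero
clamp {suc k} (suc m) = suc (clamp m)

clamp-toℕ : ∀ {k} (b : Fin (suc k)) → clamp (toℕ b) ≡ b
clamp-toℕ         zero    = refl
clamp-toℕ {suc k} (suc b) = cong suc (clamp-toℕ b)

module Witness (n s x k : ℕ) (2≤s : 2 ≤ s) (s≤n : s ≤ n) (x+2≤s : x + 2 ≤ s)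
               (s+k≡n+x : s C 2 + k ≡ n C 2 + x) where

  -- The pairs (lo, hi) of the witness graph by kind; absent carries exactly what is known about a
  -- non-edge, so that every lemma about Pair can rule out the other kinds by inversion.
  data Pair : ℕ → ℕ → Set where
    star   : ∀ {hi} → 0 < hi → hi < s → Pair 0 hi
    spoke  : ∀ {hi} → 2 ≤ hi → hi ≤ suc x → Pair 1 hi
    outer  : ∀ {lo hi} → lo < hi → s ≤ hi → Pair lo hi
    absent : ∀ {lo hi} → (lo < hi → 1 ≤ lo × hi < s × (lo ≡ 1 → suc x < hi)) → Pair lo hi

  private
    below-s : ∀ {lo hi} → lo < hi → hi < s → Pair lo hi
    below-s {zero}           0<hi hi<s = star 0<hi hi<s
    below-s {suc zero} {hi}  1<hi hi<s with hi ≤? suc x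
    ... | yes hi≤1+x = spoke 1<hi hi≤1+x
    ... | no  hi≰1+x = absent (λ _ → ≤-refl , hi<s , λ _ → ≰⇒> hi≰1+x)
    below-s {suc (suc lo)} _ hi<s = absent (λ _ → s≤s z≤n , hi<s , λ ())

  classify : ∀ lo hi → Pair lo hi
  classify lo hi with lo <? hi | s ≤? hi
  ... | no  lo≮hi | _        = absent (λ lo<hi → contradiction lo<hi lo≮hi)
  ... | yes lo<hi | yes s≤hi = outer lo<hi s≤hi
  ... | yes lo<hi | no  s≰hi = below-s lo<hi (≰⇒> s≰hi)

  isEdge : ∀ {lo hi} → Pair lo hi → Bool
  isEdge (absent _) = false
  isEdge _          = true

  outerIndex : ℕ → ℕ → ℕ
  outerIndex lo hi = hi C 2 + lo ∸ s C 2

  colourCode : ∀ {lo hi} → Pair lo hi → ℕ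
  colourCode (star _ _)              = 0
  colourCode (spoke {hi} _ _)        = suc (hi ∸ 2)
  colourCode (outer {lo} {hi} _ _)   = suc (x + outerIndex lo hi)
  colourCode (absent _)              = 0

  -- Injective on edges: star edges get keys below s ∸ 1, the others s ∸ 1 plus their colour minus 1.
  key : ∀ {lo hi} → Pair lo hi → ℕ
  key (star {hi} _ _)                = hi ∸ 1
  key (spoke {hi} _ _)               = (s ∸ 1) + (hi ∸ 2)
  key (outer {lo} {hi} _ _)          = (s ∸ 1) + (x + outerIndex lo hi)
  key (absent _)                     = 0

  pairOf : (u v : Fin n) → Pair (toℕ u ⊓ toℕ v) (toℕ u ⊔ toℕ v)
  pairOf u v = classify (toℕ u ⊓ toℕ v) (toℕ u ⊔ toℕ v)

  isEdge-diagonal : ∀ {m} (p : Pair m m) → isEdge p ≡ false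
  isEdge-diagonal (star () _)
  isEdge-diagonal (spoke (s≤s ()) _)
  isEdge-diagonal (outer m<m _) = contradiction m<m (<-irrefl refl)
  isEdge-diagonal (absent _)    = refl

  G : Graph n
  G = record
    { adj    = λ u v → isEdge (pairOf u v)
    ; sym    = λ u v → cong₂ (λ a b → isEdge (classify a b)) (⊓-comm (toℕ u) _) (⊔-comm (toℕ u) _)
    ; irrefl = λ u → trans (cong₂ (λ a b → isEdge (classify a b)) (⊓-idem (toℕ u)) (⊔-idem (toℕ u)))
                           (isEdge-diagonal (classify (toℕ u) (toℕ u)))
    }

  c : EdgeColoring G (suc k)
  c = record
    { col    = λ u v → clamp (colourCode (pairOf u v))
    ; colSym = λ u v _ → cong₂ (λ a b → clamp (colourCode (classify a b))) (⊓-comm (toℕ u) _) (⊔-comm (toℕ u) _)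
    }

  edge-at : ∀ {a lo hi} (u v : Fin n) → toℕ u ≡ lo → toℕ v ≡ hi → lo ≤ hi →
    (∀ (p : Pair lo hi) → isEdge p ≡ true × colourCode p ≡ toℕ a) →
    adj G u v ≡ true × col c u v ≡ a
  edge-at {a} {lo} {hi} u v u≡lo v≡hi lo≤hi facts =
    trans (cong₂ (λ a b → isEdge (classify a b)) min≡lo max≡hi) (proj₁ (facts (classify lo hi))) ,
    trans (cong₂ (λ a b → clamp (colourCode (classify a b))) min≡lo max≡hi)
          (trans (cong clamp (proj₂ (facts (classify lo hi)))) (clamp-toℕ a))
    where
    min≡lo : toℕ u ⊓ toℕ v ≡ lo
    min≡lo = trans (cong₂ _⊓_ u≡lo v≡hi) (m≤n⇒m⊓n≡m lo≤hi)
    max≡hi : toℕ u ⊔ toℕ v ≡ hi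
    max≡hi = trans (cong₂ _⊔_ u≡lo v≡hi) (m≤n⇒m⊔n≡n lo≤hi)

  private
    hi≤1+x⇒hi<s : ∀ {hi} → hi ≤ suc x → hi < s
    hi≤1+x⇒hi<s hi≤1+x = <-≤-trans (s≤s hi≤1+x) (subst (_≤ s) (+-comm x 2) x+2≤s)

  star-facts : ∀ {hi} → 0 < hi → hi < s → (p : Pair 0 hi) → isEdge p ≡ true × colourCode p ≡ 0
  star-facts _    _    (star _ _)     = refl , refl
  star-facts _    hi<s (outer _ s≤hi) = contradiction s≤hi (<⇒≱ hi<s)
  star-facts 0<hi _    (absent f)     with f 0<hi
  ... | () , _

  spoke-facts : ∀ {hi} → 2 ≤ hi → hi ≤ suc x → (p : Pair 1 hi) → isEdge p ≡ true × colourCode p ≡ suc (hi ∸ 2)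
  spoke-facts _    _      (spoke _ _)    = refl , refl
  spoke-facts _    hi≤1+x (outer _ s≤hi) = contradiction s≤hi (<⇒≱ (hi≤1+x⇒hi<s hi≤1+x))
  spoke-facts 2≤hi hi≤1+x (absent f)     = contradiction hi≤1+x (<⇒≱ (proj₂ (proj₂ (f 2≤hi)) refl))

  outer-facts : ∀ {lo hi} → lo < hi → s ≤ hi → (p : Pair lo hi) →
                isEdge p ≡ true × colourCode p ≡ suc (x + outerIndex lo hi)
  outer-facts _     s≤hi (star _ hi<s)      = contradiction s≤hi (<⇒≱ hi<s)
  outer-facts _     s≤hi (spoke _ hi≤1+x)   = contradiction s≤hi (<⇒≱ (hi≤1+x⇒hi<s hi≤1+x))
  outer-facts _     _    (outer _ _)        = refl , refl
  outer-facts lo<hi s≤hi (absent f)         = contradiction s≤hi (<⇒≱ (proj₁ (proj₂ (f lo<hi))))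

  absent-facts : ∀ {lo hi} (p : Pair lo hi) → isEdge p ≡ false → lo < hi → 1 ≤ lo × hi < s
  absent-facts (absent f) _ lo<hi = proj₁ (f lo<hi) , proj₁ (proj₂ (f lo<hi))

  private
    1≤n : 1 ≤ n
    1≤n = ≤-trans (s≤s z≤n) (≤-trans 2≤s s≤n)

    2≤n : 2 ≤ n
    2≤n = ≤-trans 2≤s s≤n

  centre : Fin n
  centre = fromℕ< 1≤n

  star-edge : ∀ w → 1 ≤ toℕ w → toℕ w < s → adj G centre w ≡ true × col c centre w ≡ zero
  star-edge w 1≤w w<s = edge-at centre w (Fin.toℕ-fromℕ< 1≤n) refl z≤n (star-facts 1≤w w<s)

  via-centre : ∀ {u v} → 1 ≤ toℕ u → toℕ u < s → 1 ≤ toℕ v → toℕ v < s → MonoWalk G c zero u v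
  via-centre {u} {v} 1≤u u<s 1≤v v<s with star-edge u 1≤u u<s | star-edge v 1≤v v<s
  ... | cu , cu-col | cv , cv-col = step uc (trans (colSym c u centre uc) cu-col) (step cv cv-col here)
    where
    uc = trans (Graph.sym G u centre) cu

  mc : IsMC c
  mc u v with u Fin.≟ v
  ... | yes refl = zero , here
  ... | no u≢v with isEdge (pairOf u v) in uv
  ...   | true  = col c u v , step uv refl here
  ...   | false with absent-facts (pairOf u v) uv (m≢n⇒m⊓n<m⊔n (u≢v ∘ Fin.toℕ-injective))
  ...     | 1≤lo , hi<s = zero , via-centre (≤-trans 1≤lo (m⊓n≤m _ _)) (≤-<-trans (m≤m⊔n _ _) hi<s)
                                             (≤-trans 1≤lo (m⊓n≤n _ _)) (≤-<-trans (m≤n⊔m _ _) hi<s)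

  private
    edge-between : ∀ {a lo hi} (lo<n : lo < n) (hi<n : hi < n) → lo ≤ hi →
      (∀ (p : Pair lo hi) → isEdge p ≡ true × colourCode p ≡ toℕ a) →
      Σ (Fin n) λ u → Σ (Fin n) λ v → (adj G u v ≡ true) × (col c u v ≡ a)
    edge-between lo<n hi<n lo≤hi facts =
      fromℕ< lo<n , fromℕ< hi<n , edge-at _ _ (Fin.toℕ-fromℕ< lo<n) (Fin.toℕ-fromℕ< hi<n) lo≤hi facts

  uses : UsesAll c
  uses zero = edge-between 1≤n 2≤n z≤n (star-facts ≤-refl 2≤s)
  uses (suc b) with toℕ b <? x
  ... | yes b<x = edge-between 2≤n (<-≤-trans (hi≤1+x⇒hi<s (s≤s b<x)) s≤n) (s≤s z≤n)
                                (spoke-facts (s≤s (s≤s z≤n)) (s≤s b<x))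
  ... | no b≮x with pair-decode n (s C 2 + (toℕ b ∸ x)) target<nC2
    where
    target<nC2 : s C 2 + (toℕ b ∸ x) < n C 2
    target<nC2 = +-cancelʳ-< x _ _ (begin-strict
      s C 2 + (toℕ b ∸ x) + x      ≡⟨ +-assoc (s C 2) _ x ⟩
      s C 2 + (toℕ b ∸ x + x)      ≡⟨ cong (s C 2 +_) (m∸n+n≡m (≮⇒≥ b≮x)) ⟩
      s C 2 + toℕ b                <⟨ +-monoʳ-< (s C 2) (Fin.toℕ<n b) ⟩
      s C 2 + k                    ≡⟨ s+k≡n+x ⟩
      n C 2 + x                    ∎)
      where open ≤-Reasoning
  ...   | lo , hi , lo<hi , hi<n , code≡ =
    edge-between (<-trans lo<hi hi<n) hi<n (<⇒≤ lo<hi)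
      (λ p → subst (λ d → isEdge p ≡ true × colourCode p ≡ suc d) index≡b (outer-facts lo<hi s≤hi p))
    where
    s≤hi : s ≤ hi
    s≤hi = ≮⇒≥ λ hi<s → contradiction code≡ (<⇒≢ (pair-code-mono lo<hi hi<s))
    index≡b : x + outerIndex lo hi ≡ toℕ b
    index≡b = begin
      x + (hi C 2 + lo ∸ s C 2)          ≡⟨ cong (λ d → x + (d ∸ s C 2)) code≡ ⟩
      x + (s C 2 + (toℕ b ∸ x) ∸ s C 2)  ≡⟨ cong (x +_) (m+n∸m≡n (s C 2) _) ⟩
      x + (toℕ b ∸ x)                    ≡⟨ m+[n∸m]≡n (≮⇒≥ b≮x) ⟩
      toℕ b                              ∎
      where open ≡-Reasoning

  private
    x≤k : x ≤ k
    x≤k = +-cancelˡ-≤ (s C 2) x k (≤-trans (+-monoˡ-≤ x (C2-mono s≤n)) (≤-reflexive (sym s+k≡n+x)))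

    code<nC2 : ∀ {lo hi} → lo < hi → hi < n → hi C 2 + lo < n C 2
    code<nC2 lo<hi hi<n = <-≤-trans (pair-code-< lo<hi) (C2-mono hi<n)

    s≤code : ∀ {lo hi} → s ≤ hi → s C 2 ≤ hi C 2 + lo
    s≤code s≤hi = ≤-trans (C2-mono s≤hi) (m≤m+n _ _)

    outer-colour<k : ∀ {lo hi} → lo < hi → s ≤ hi → hi < n → x + outerIndex lo hi < k
    outer-colour<k {lo} {hi} lo<hi s≤hi hi<n = +-cancelʳ-< (s C 2) _ _ (begin-strict
      x + outerIndex lo hi + s C 2        ≡⟨ +-assoc x _ (s C 2) ⟩
      x + (outerIndex lo hi + s C 2)      ≡⟨ cong (x +_) (m∸n+n≡m (s≤code s≤hi)) ⟩
      x + (hi C 2 + lo)                   <⟨ +-monoʳ-< x (code<nC2 lo<hi hi<n) ⟩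
      x + n C 2                           ≡⟨ +-comm x (n C 2) ⟩
      n C 2 + x                           ≡⟨ sym s+k≡n+x ⟩
      s C 2 + k                           ≡⟨ +-comm (s C 2) k ⟩
      k + s C 2                           ∎)
      where open ≤-Reasoning

  key<K : ∀ {lo hi} (p : Pair lo hi) → isEdge p ≡ true → hi < n → key p < (s ∸ 1) + k
  key<K (star 0<hi hi<s)   _ _    = <-≤-trans (∸-monoˡ-< hi<s 0<hi) (m≤m+n _ _)
  key<K (spoke {suc (suc h)} _ (s≤s h<x)) _ _ = +-monoʳ-< (s ∸ 1) (<-≤-trans h<x x≤k)
  key<K (spoke {suc zero} (s≤s ()) _) _ _
  key<K (outer lo<hi s≤hi) _ hi<n = +-monoʳ-< (s ∸ 1) (outer-colour<k lo<hi s≤hi hi<n)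
  key<K (absent _) () _

  private
    star-key<s∸1 : ∀ {hi} → 0 < hi → hi < s → hi ∸ 1 < s ∸ 1
    star-key<s∸1 0<hi hi<s = ∸-monoˡ-< hi<s 0<hi

    low≢high : ∀ {a b} → a < s ∸ 1 → a ≢ (s ∸ 1) + b
    low≢high {a} {b} a<s∸1 = <⇒≢ (<-≤-trans a<s∸1 (m≤m+n (s ∸ 1) b))

    spoke≢outer : ∀ {h i} → h < x → (s ∸ 1) + h ≢ (s ∸ 1) + (x + i)
    spoke≢outer {h} {i} h<x eq = contradiction (+-cancelˡ-≡ (s ∸ 1) h (x + i) eq) (<⇒≢ (<-≤-trans h<x (m≤m+n x i)))

  key-injective : ∀ {lo hi lo′ hi′} (p : Pair lo hi) (p′ : Pair lo′ hi′) →
                  isEdge p ≡ true → isEdge p′ ≡ true → key p ≡ key p′ → lo ≡ lo′ × hi ≡ hi′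
  key-injective (star (s≤s z≤n) _) (star (s≤s z≤n) _) _ _ eq = refl , cong suc eq
  key-injective (star 0<hi hi<s) (spoke _ _) _ _ eq = contradiction eq (low≢high (star-key<s∸1 0<hi hi<s))
  key-injective (star 0<hi hi<s) (outer _ _) _ _ eq = contradiction eq (low≢high (star-key<s∸1 0<hi hi<s))
  key-injective (spoke _ _) (star 0<hi hi<s) _ _ eq = contradiction (sym eq) (low≢high (star-key<s∸1 0<hi hi<s))
  key-injective (outer _ _) (star 0<hi hi<s) _ _ eq = contradiction (sym eq) (low≢high (star-key<s∸1 0<hi hi<s))
  key-injective (spoke {suc (suc h)} _ _) (spoke {suc (suc h′)} _ _) _ _ eq =
    refl , cong (λ h → 2 + h) (+-cancelˡ-≡ (s ∸ 1) h h′ eq)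
  key-injective (spoke {suc (suc h)} _ (s≤s h<x)) (outer _ _) _ _ eq = contradiction eq (spoke≢outer h<x)
  key-injective (outer _ _) (spoke {suc (suc h)} _ (s≤s h<x)) _ _ eq = contradiction (sym eq) (spoke≢outer h<x)
  key-injective (outer lo<hi s≤hi) (outer lo′<hi′ s≤hi′) _ _ eq =
    pair-code-injective lo<hi lo′<hi′
      (∸-cancelʳ-≡ (s≤code s≤hi) (s≤code s≤hi′) (+-cancelˡ-≡ x _ _ (+-cancelˡ-≡ (s ∸ 1) _ _ eq)))
  key-injective (spoke {suc zero} (s≤s ()) _) _ _ _ _
  key-injective _ (spoke {suc zero} (s≤s ()) _) _ _ _
  key-injective (absent _) _ () _ _
  key-injective _ (absent _) _ () _

  private
    counted-edge : ∀ {u v} → edgeIndicator G u v ≡ 1 → toℕ u < toℕ v × isEdge (pairOf u v) ≡ true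
    counted-edge {u} {v} e with toℕ u <ᵇ toℕ v in u<ᵇv | isEdge (pairOf u v) in uv
    ... | true  | true = <ᵇ⇒< (toℕ u) (toℕ v) (from T-≡ u<ᵇv) , refl
    ... | true  | false with () ← e
    ... | false | _     with () ← e

  few-edges : edgeCount G ≤ (s ∸ 1) + k
  few-edges = subst (_≤ (s ∸ 1) + k) (sym (edgeCount≡∑∑ G))
    (∑∑≤-by-injection ((s ∸ 1) + k) (edgeIndicator G) (λ u v → key (pairOf u v)) (λ u v → 𝟙≤1 _)
       (λ {u} {v} → bound {u} {v}) (λ {u} {v} {u′} {v′} → injective {u} {v} {u′} {v′}))
    where
    bound : ∀ {u v} → edgeIndicator G u v ≡ 1 → key (pairOf u v) < (s ∸ 1) + k
    bound {u} {v} e = key<K (pairOf u v) (proj₂ (counted-edge {u} {v} e)) (⊔-lub (Fin.toℕ<n u) (Fin.toℕ<n v))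

    ends : ∀ {u v} → toℕ u < toℕ v → toℕ u ⊓ toℕ v ≡ toℕ u × toℕ u ⊔ toℕ v ≡ toℕ v
    ends u<v = m≤n⇒m⊓n≡m (<⇒≤ u<v) , m≤n⇒m⊔n≡n (<⇒≤ u<v)

    injective : ∀ {u v u′ v′} → edgeIndicator G u v ≡ 1 → edgeIndicator G u′ v′ ≡ 1 →
                key (pairOf u v) ≡ key (pairOf u′ v′) → u ≡ u′ × v ≡ v′
    injective {u} {v} {u′} {v′} e e′ eq with counted-edge {u} {v} e | counted-edge {u′} {v′} e′
    ... | u<v , uv | u′<v′ , u′v′ with key-injective (pairOf u v) (pairOf u′ v′) uv u′v′ eq
    ...   | min≡ , max≡ =
      Fin.toℕ-injective (trans (sym (proj₁ (ends u<v))) (trans min≡ (proj₁ (ends u′<v′)))) ,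
      Fin.toℕ-injective (trans (sym (proj₂ (ends u<v))) (trans max≡ (proj₂ (ends u′<v′))))

  not-goodBound : ¬ GoodBound n k ((s ∸ 1) + k)
  not-goodBound good = 1+n≰n (good G (λ u v → MonoWalk⇒Walk (proj₂ (mc u v))) few-edges (suc k) c uses mc)

IsG-intro : ∀ {n k v} → v + (v ∸ k) C 2 < n C 2 → ¬ GoodBound n k (suc v) → IsG n k v
IsG-intro {n} {k} {v} bound bad =
  ≤-trans (m≤m+n v _) (<⇒≤ bound) , goodBound-by-counting n k v bound , λ m _ → GoodBound⇒≤ bad m

-- The witness with s = t + 1 and x = k − C(p,2) − t(p − 1) spokes.
¬GoodBound-k+t : ∀ p′ q y k → suc p′ C 2 + (2 + q) * p′ + 1 + y ≡ k → k < suc p′ C 2 + (2 + q) * suc p′ →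
                 ¬ GoodBound (suc p′ + (2 + q)) k ((2 + q) + k)
¬GoodBound-k+t p′ q y k k≡ k<At =
  Witness.not-goodBound n (suc t) (suc y) k (s≤s (s≤s z≤n)) (s≤s (m≤n+m t p′)) x+2≤s s+k≡n+x
  where
  p = suc p′
  t = 2 + q
  n = p + t
  A = p C 2
  x+2≤s : suc y + 2 ≤ suc t
  x+2≤s = s≤s (+-cancelˡ-≤ (A + t * p′) (y + 2) t (begin
    A + t * p′ + (y + 2)                 ≡⟨ shift (A + t * p′) y ⟩
    A + t * p′ + 1 + y + 1               ≡⟨ cong (_+ 1) k≡ ⟩
    k + 1                                ≡⟨ +-comm k 1 ⟩
    suc k                                ≤⟨ k<At ⟩
    A + t * p                            ≡⟨ spread A t p′ ⟩
    A + t * p′ + t                       ∎))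
    where
    open ≤-Reasoning
    shift : ∀ a y → a + (y + 2) ≡ a + 1 + y + 1
    shift = solve-∀
    spread : ∀ a t p′ → a + t * suc p′ ≡ a + t * p′ + t
    spread = solve-∀
  s+k≡n+x : suc t C 2 + k ≡ n C 2 + suc y
  s+k≡n+x = begin
    suc t C 2 + k                            ≡⟨ cong₂ _+_ (C2-suc t) (sym k≡) ⟩
    t + t C 2 + (A + t * p′ + 1 + y)         ≡⟨ regroup t (t C 2) A p′ y ⟩
    A + t * p + t C 2 + suc y                ≡⟨ cong (_+ suc y) (sym (C2-+ p t)) ⟩
    n C 2 + suc y                            ∎
    where
    open ≡-Reasoning
    regroup : ∀ t T A p′ y → t + T + (A + t * p′ + 1 + y) ≡ A + t * suc p′ + T + suc y
    regroup = solve-∀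

-- The witness with s = t and no spokes.
¬GoodBound-k+t∸1 : ∀ p′ q → let k = suc p′ C 2 + (2 + q) * suc p′ in
                   ¬ GoodBound (suc p′ + (2 + q)) k (suc q + k)
¬GoodBound-k+t∸1 p′ q =
  Witness.not-goodBound (p + t) t 0 (p C 2 + t * p) (s≤s (s≤s z≤n)) (m≤n+m t p) (s≤s (s≤s z≤n))
    (trans (+-comm (t C 2) _) (trans (sym (C2-+ p t)) (sym (+-identityʳ _))))
  where
  p = suc p′
  t = 2 + q

IsG-k+t∸1 : ∀ p′ q k → suc p′ C 2 + (2 + q) * p′ + 1 ≤ k → k ≤ suc p′ C 2 + (2 + q) * suc p′ ∸ 1 →
            IsG (suc p′ + (2 + q)) k (k + (2 + q) ∸ 1)
IsG-k+t∸1 p′ q k low high with m≤n⇒∃[o]m+o≡n low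
... | y , k≡ = subst (IsG n k) (sym (cong (_∸ 1) (+-suc k (suc q)))) (IsG-intro bound bad)
  where
  p = suc p′
  t = 2 + q
  n = p + t
  A = p C 2
  k<At : k < A + t * p
  k<At = ≤∸1⇒< (≤-trans (s≤s z≤n) (m≤n+m (t * p) A)) high
  bound : k + suc q + (k + suc q ∸ k) C 2 < n C 2
  bound = begin-strict
    k + suc q + (k + suc q ∸ k) C 2      ≡⟨ cong (λ d → k + suc q + d C 2) (m+n∸m≡n k (suc q)) ⟩
    k + suc q + suc q C 2                ≡⟨ +-assoc k (suc q) _ ⟩
    k + (suc q + suc q C 2)              <⟨ +-monoˡ-< _ k<At ⟩
    A + t * p + (suc q + suc q C 2)      ≡⟨ cong (A + t * p +_) (sym (C2-suc (suc q))) ⟩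
    A + t * p + t C 2                    ≡⟨ sym (C2-+ p t) ⟩
    n C 2                                ∎
    where open ≤-Reasoning
  bad : ¬ GoodBound n k (suc (k + suc q))
  bad = subst (λ e → ¬ GoodBound n k e) (cong suc (+-comm (suc q) k)) (¬GoodBound-k+t p′ q y k k≡ k<At)

IsG-k+t∸2 : ∀ p′ q → let k = suc p′ C 2 + (2 + q) * suc p′ in
            IsG (suc p′ + (2 + q)) k (k + (2 + q) ∸ 2)
IsG-k+t∸2 p′ q = subst (IsG n k) (sym (cong (_∸ 2) (trans (+-suc k (suc q)) (cong suc (+-suc k q)))))
                       (IsG-intro bound bad)
  where
  p = suc p′
  t = 2 + q
  n = p + t
  k = p C 2 + t * p
  bound : k + q + (k + q ∸ k) C 2 < n C 2
  bound = begin-strict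
    k + q + (k + q ∸ k) C 2          ≡⟨ cong (λ d → k + q + d C 2) (m+n∸m≡n k q) ⟩
    k + q + q C 2                    ≡⟨ +-assoc k q _ ⟩
    k + (q + q C 2)                  <⟨ +-monoʳ-< k (s≤s (m≤n+m _ q)) ⟩
    k + (suc q + (q + q C 2))        ≡⟨ cong (λ d → k + (suc q + d)) (sym (C2-suc q)) ⟩
    k + (suc q + suc q C 2)          ≡⟨ cong (k +_) (sym (C2-suc (suc q))) ⟩
    k + t C 2                        ≡⟨ sym (C2-+ p t) ⟩
    n C 2                            ∎
    where open ≤-Reasoning
  bad : ¬ GoodBound n k (suc (k + q))
  bad = subst (λ e → ¬ GoodBound n k e) (cong suc (+-comm q k)) (¬GoodBound-k+t∸1 p′ q)

split-vertices : ∀ {n t} → 1 ≤ n → t ≤ n ∸ 1 → ∃ λ p′ → n ≡ suc p′ + t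
split-vertices {suc n} {t} _ t≤n with m≤n⇒∃[o]m+o≡n t≤n
... | p′ , t+p′≡n = p′ , cong suc (trans (sym t+p′≡n) (+-comm t p′))

theorem4 : ∀ (n k : ℕ) → 1 ≤ n → 1 ≤ k → k ≤ n C 2 →
    (k ≡ n C 2 → IsG n k (n C 2)) ×
    (∀ (t : ℕ) → 2 ≤ t → t ≤ n ∸ 1 →
      ((n ∸ t) C 2 + t * (n ∸ t ∸ 1) + 1 ≤ k → k ≤ (n ∸ t) C 2 + t * (n ∸ t) ∸ 1 →
         IsG n k (k + t ∸ 1)) ×
      (k ≡ (n ∸ t) C 2 + t * (n ∸ t) → IsG n k (k + t ∸ 2)))
theorem4 n k 1≤n _ _ = complete , thresholds
  where
  complete : k ≡ n C 2 → IsG n k (n C 2)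
  complete refl = ≤-refl , (λ G _ few j c uses _ → ≤-trans (colours≤edges c uses) few) , (λ _ m≤C _ → m≤C)

  thresholds : ∀ t → 2 ≤ t → t ≤ n ∸ 1 →
    ((n ∸ t) C 2 + t * (n ∸ t ∸ 1) + 1 ≤ k → k ≤ (n ∸ t) C 2 + t * (n ∸ t) ∸ 1 → IsG n k (k + t ∸ 1)) ×
    (k ≡ (n ∸ t) C 2 + t * (n ∸ t) → IsG n k (k + t ∸ 2))
  thresholds t@(suc (suc q)) _ t≤n∸1 with split-vertices 1≤n t≤n∸1
  ... | p′ , refl rewrite m+n∸n≡m (suc p′) t = IsG-k+t∸1 p′ q k , λ { refl → IsG-k+t∸2 p′ q }
  thresholds (suc zero) (s≤s ()) _
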